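{- For $u\in V$, let $D_u$ be the event that $u$ is detected, and let $E_u$ be the event that there exists at least one four-cycle rooted at $u$ in $G$ containing at least one long-range edge (i.e. a four-cycle rooted at $u$ in $G$ that is not in $T$). Then $\Pr(D_u)\ge 1-4\Pr(E_u)$.
   Context: Let $n\ge 3$ be an integer and $[\![n]\!]=\{0,1,\dots,n-1\}$. The torus $T=(V,E_T)$ has $V=[\![n]\!]^2$, with $(i,j)$ adjacent to $(i,(j+1)\bmod n)$ and $((i+1)\bmod n,j)$. For $u=(x_u,y_u),v=(x_v,y_v)$, $d_{uv}=\min(|x_u-x_v|,n-|x_u-x_v|)+\min(|y_u-y_v|,n-|y_u-y_v|)$. Let $Z=\left(\sum_{w\in V\setminus\{u\}} d_{uw}^{ -2}\right)^{ -1}$ (independent of $u$). The UTSW random graph $G=(V,E)$: independently for each $u\in V$, $u$ chooses one $v\in V\setminus\{u\}$ with probability $Z\,d_{uv}^{ -2}$, and $E=E_T\cup\{\{u,v\}:u\text{ chose }v\}$ without parallel edges. Edges in $E_T$ are local, edges in $E\setminus E_T$ are long-range. A four-cycle rooted at $u$ is a sequence $(u,v_1,v_2,v_3)$ of four pairwise distinct vertices with $\{u,v_1\},\{v_1,v_2\},\{v_2,v_3\},\{v_3,u\}\in E$; a cycle and its reversal $(u,v_3,v_2,v_1)$ are identified. Lattice pattern: a set $\mathcal{C}$ of four four-cycles is a lattice pattern if there is an ordering $(C^0,C^1,C^2,C^3)$ of $\mathcal{C}$ such that, for all $0\le k\le 3$: (i) every $C^k$ contains the same vertex $u$; (ii)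 $C^k$ and $C^{(k+1)\bmod 4}$ share an edge $\{u,a_k\}$, these four edges being distinct; (iii) $C^k$ contains a vertex $b_k\ne u$ adjacent in $C^k$ to both $a_{(k-1)\bmod 4}$ and $a_k$; (iv) the nine vertices $u,a_0,\dots,a_3,b_0,\dots,b_3$ are pairwise distinct. Detection: let $\mathcal{L}_u$ be the set of four-cycles in $G$ rooted at $u$; let $E''_u$ be the union, over all $4$-element subsets $\mathcal{C}\subseteq\mathcal{L}_u$ that are lattice patterns, of the set of edges of cycles in $\mathcal{C}$ that are incident to $u$. The vertex $u$ is detected if $|E''_u|=4$. -}

module Defs where

open import Data.Bool using (Bool; true; false; _∧_; _∨_; not; if_then_else_)
open import Data.Nat as ℕ using (ℕ; zero; suc; _∸_; _⊓_; ∣_-_∣; _≡ᵇ_)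
open import Data.Fin as Fin using (Fin; toℕ)
import Data.Fin.Properties as FinP
open import Data.Product using (_×_; _,_; proj₁; proj₂)
open import Data.List using (List; []; _∷_; map; concatMap; cartesianProduct; allFin; filterᵇ; foldr; length)
import Data.Vec.Functional as VF
open import Data.Bool.ListAction using (any; all)
open import Function using (_∘_)
open import Data.Integer using (+_)
open import Data.Rational as ℚ using (ℚ; 0ℚ; 1ℚ; 1/_; _≟_)
import Data.Rational.Properties as ℚP
open import Relation.Nullary using (yes; no)
open import Relation.Nullary.Decidable using (⌊_⌋)

V : ℕ → Set
V n = Fin n × Fin n

vertices : (n : ℕ) → List (V n)
vertices n = cartesianProduct (allFin n) (allFin n)

_==_ : {n : ℕ} → V n → V n → Bool
(a , b) == (c , d) = ⌊ a Fin.≟ c ⌋ ∧ ⌊ b Fin.≟ d ⌋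

_≠_ : {n : ℕ} → V n → V n → Bool
p ≠ q = not (p == q)

isSuccMod : (n : ℕ) → Fin n → Fin n → Bool
isSuccMod n j j' = (toℕ j' ≡ᵇ suc (toℕ j)) ∨ ((toℕ j ≡ᵇ n ∸ 1) ∧ (toℕ j' ≡ᵇ 0))

torusArc : {n : ℕ} → V n → V n → Bool
torusArc {n} (i , j) (i' , j') =
  (⌊ i Fin.≟ i' ⌋ ∧ isSuccMod n j j') ∨ (isSuccMod n i i' ∧ ⌊ j Fin.≟ j' ⌋)

localEdge : {n : ℕ} → V n → V n → Bool
localEdge p q = torusArc p q ∨ torusArc q p

cdist : ℕ → ℕ → ℕ → ℕ
cdist n a b = ∣ a - b ∣ ⊓ (n ∸ ∣ a - b ∣)

dist : {n : ℕ} → V n → V n → ℕ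
dist {n} (x , y) (x' , y') = cdist n (toℕ x) (toℕ x') ℕ.+ cdist n (toℕ y) (toℕ y')

-- d^{-2} (d ≥ 1 whenever u ≠ v; the value at d = 0 is never used with positive weight)
invSq : ℕ → ℚ
invSq zero    = 0ℚ
invSq (suc k) = + 1 ℚ./ (suc k ℕ.* suc k)

-- reciprocal (total; the argument is always nonzero where it is used)
recip : ℚ → ℚ
recip p with p ≟ 0ℚ
... | yes _  = 0ℚ
... | no p≢0 = 1/_ p {{ℚ.≢-nonZero p≢0}}

sumℚ : List ℚ → ℚ
sumℚ = foldr ℚ._+_ 0ℚ

prodℚ : List ℚ → ℚ
prodℚ = foldr ℚ._*_ 1ℚ

-- The UTSW probability space: a choice function c : V → V (c u = the vertex u chose)

Z : {n : ℕ} → V n → ℚ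
Z {n} u = recip (sumℚ (map (λ w → invSq (dist u w)) (filterᵇ (λ w → w ≠ u) (vertices n))))

finFuns : {A : Set} (k : ℕ) → List A → List (Fin k → A)
finFuns zero    xs = (λ ()) ∷ []
finFuns (suc k) xs = concatMap (λ x → map (λ g → x VF.∷ g) (finFuns k xs)) xs

choices : (n : ℕ) → List (V n → V n)
choices n = map (λ f → λ { (i , j) → f i j }) (finFuns n (finFuns n (vertices n)))

-- probability of a choice function: ∏_u Z d_{u,c(u)}^{-2}
-- (choices with c u = u get weight 0, so effectively u chooses v ≠ u)
weight : {n : ℕ} → (V n → V n) → ℚ
weight {n} c = prodℚ (map (λ x → Z x ℚ.* invSq (dist x (c x))) (vertices n))

Pr : (n : ℕ) → ((V n → V n) → Bool) → ℚ
Pr n A = sumℚ (map (λ c → if A c then weight c else 0ℚ) (choices n))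

-- {p,q} ∈ E  (no loops, no parallel edges: E is a set of 2-subsets)
edge : {n : ℕ} → (V n → V n) → V n → V n → Bool
edge c p q = (p ≠ q) ∧ (localEdge p q ∨ (c p == q) ∨ (c q == p))

longEdge : {n : ℕ} → (V n → V n) → V n → V n → Bool
longEdge c p q = edge c p q ∧ not (localEdge p q)

-- a four-cycle rooted at u is (u , v1 , v2 , v3); we store the triple (v1 , v2 , v3)
Cyc : ℕ → Set
Cyc n = V n × V n × V n

distinctList : {n : ℕ} → List (V n) → Bool
distinctList []       = true
distinctList (x ∷ xs) = all (λ y → x ≠ y) xs ∧ distinctList xs

isCycle : {n : ℕ} → (V n → V n) → V n → Cyc n → Bool
isCycle c u (v1 , v2 , v3) =
  distinctList (u ∷ v1 ∷ v2 ∷ v3 ∷ []) ∧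
  edge c u v1 ∧ edge c v1 v2 ∧ edge c v2 v3 ∧ edge c v3 u

-- L_u (each cycle listed in both orientations)
cycles : {n : ℕ} → (V n → V n) → V n → List (Cyc n)
cycles {n} c u =
  filterᵇ (isCycle c u) (cartesianProduct (vertices n) (cartesianProduct (vertices n) (vertices n)))

-- a cycle is identified with its reversal (u , v3 , v2 , v1)
sameCycle : {n : ℕ} → Cyc n → Cyc n → Bool
sameCycle (a , b , d) (a' , b' , d') =
  (a == a' ∧ b == b' ∧ d == d') ∨ (a == d' ∧ b == b' ∧ d == a')

sameEdge : {n : ℕ} → V n → V n → V n → V n → Bool
sameEdge p q x y = (p == x ∧ q == y) ∨ (p == y ∧ q == x)

cycEdge : {n : ℕ} → V n → Cyc n → V n → V n → Bool
cycEdge u (v1 , v2 , v3) p q =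
  sameEdge p q u v1 ∨ sameEdge p q v1 v2 ∨ sameEdge p q v2 v3 ∨ sameEdge p q v3 u

cycHas : {n : ℕ} → V n → Cyc n → V n → Bool
cycHas u (v1 , v2 , v3) x = (x == u) ∨ (x == v1) ∨ (x == v2) ∨ (x == v3)

next prev : Fin 4 → Fin 4
next Fin.zero = Fin.suc Fin.zero
next (Fin.suc Fin.zero) = Fin.suc (Fin.suc Fin.zero)
next (Fin.suc (Fin.suc Fin.zero)) = Fin.suc (Fin.suc (Fin.suc Fin.zero))
next (Fin.suc (Fin.suc (Fin.suc Fin.zero))) = Fin.zero
prev Fin.zero = Fin.suc (Fin.suc (Fin.suc Fin.zero))
prev (Fin.suc Fin.zero) = Fin.zero
prev (Fin.suc (Fin.suc Fin.zero)) = Fin.suc Fin.zero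
prev (Fin.suc (Fin.suc (Fin.suc Fin.zero))) = Fin.suc (Fin.suc Fin.zero)

-- The ordering (C^0,C^1,C^2,C^3) of four cycles rooted at u witnesses a lattice pattern:
-- there are a common vertex w (the "u" of the definition) and a_k, b_k with (i)-(iv).
latticeOrdering : {n : ℕ} → V n → (Fin 4 → Cyc n) → Bool
latticeOrdering {n} u C =
  any (λ w → any (λ a → any (λ b →
      all (λ k →
          cycHas u (C k) w ∧
          cycEdge u (C k) w (a k) ∧ cycEdge u (C (next k)) w (a k) ∧
          (b k ≠ w) ∧ cycHas u (C k) (b k) ∧
          cycEdge u (C k) (b k) (a (prev k)) ∧ cycEdge u (C k) (b k) (a k))
        (allFin 4) ∧
      all (λ k → all (λ l → ⌊ k Fin.≟ l ⌋ ∨ not (sameEdge w (a k) w (a l))) (allFin 4)) (allFin 4) ∧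
      distinctList (w ∷ a Fin.zero ∷ a (Fin.suc Fin.zero) ∷ a (Fin.suc (Fin.suc Fin.zero))
                      ∷ a (Fin.suc (Fin.suc (Fin.suc Fin.zero)))
                      ∷ b Fin.zero ∷ b (Fin.suc Fin.zero) ∷ b (Fin.suc (Fin.suc Fin.zero))
                      ∷ b (Fin.suc (Fin.suc (Fin.suc Fin.zero))) ∷ []))
    (finFuns 4 (vertices n))) (finFuns 4 (vertices n))) (vertices n)

-- ordered 4-tuples of pairwise distinct (up to reversal) cycles of L_u forming a lattice
-- pattern; their underlying sets are exactly the 4-element subsets of L_u that are lattice patterns
latticePatterns : {n : ℕ} → (V n → V n) → V n → List (Fin 4 → Cyc n)
latticePatterns c u =
  filterᵇ (λ C → all (λ k → all (λ l → ⌊ k Fin.≟ l ⌋ ∨ not (sameCycle (C k) (C l))) (allFin 4)) (allFin 4)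
                 ∧ latticeOrdering u C)
          (finFuns 4 (cycles c u))

inE'' : {n : ℕ} → (V n → V n) → V n → V n → Bool
inE'' c u x = any (λ C → any (λ k → cycEdge u (C k) u x) (allFin 4)) (latticePatterns c u)

-- D_u : |E''_u| = 4  (edges incident to u correspond bijectively to their other endpoint)
detected : {n : ℕ} → V n → (V n → V n) → Bool
detected {n} u c = length (filterᵇ (λ x → (x ≠ u) ∧ inE'' c u x) (vertices n)) ≡ᵇ 4

hasLongCycle : {n : ℕ} → V n → (V n → V n) → Bool
hasLongCycle u c =
  any (λ { (v1 , v2 , v3) → longEdge c u v1 ∨ longEdge c v1 v2 ∨ longEdge c v2 v3 ∨ longEdge c v3 u })
      (cycles c u)

-- If no four-cycle rooted at u contains a long-range edge, then u is detected; hence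
-- Pr(D_u) ≥ 1 − Pr(E_u) ≥ 1 − 4 Pr(E_u).  For n ≥ 3 the 3 × 3 grid embeds injectively into
-- the torus around u, and its four unit squares at the centre form a lattice pattern: the
-- defining conditions are boolean combinations of vertex equalities, so they are checked by
-- evaluation on the grid and transported along the embedding.  Thus the four torus edges
-- at u always lie in E''_u.  Conversely an edge at u of a cycle in L_u is an edge of G, so
-- it is local when no such cycle has a long-range edge, and E''_u is exactly the set of
-- four torus edges at u.  On the probability side it only matters that the UTSW weights
-- are nonnegative with total mass 1: summing the product of the per-vertex choice
-- probabilities over all choice functions gives the product of the per-vertex sums, each
-- of which is 1 by the definition of Z.
module Submission where

open import Defs
open import Algebra.Bundles using (CommutativeMonoid)
import Algebra.Properties.AbelianGroup
import Algebra.Properties.CommutativeSemigroup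
open import Data.Bool using (Bool; true; false; _∧_; _∨_; not; T; T?; if_then_else_)
open import Data.Bool.ListAction using (any; all; and)
open import Data.Bool.Properties using (T-∧; T-∨; T-not-≡)
open import Data.Empty using (⊥-elim)
open import Data.Fin as Fin using (Fin; toℕ; fromℕ; fromℕ<; inject₁)
open import Data.Fin.Patterns using (0F; 1F; 2F; 3F)
import Data.Fin.Properties as Fin
open import Data.Integer using (+_)
open import Data.List using (List; []; _∷_; _++_; map; allFin; filterᵇ; concatMap; cartesianProduct; length)
open import Data.List.Membership.Propositional using (_∈_; lose; find)
open import Data.List.Membership.Propositional.Properties
  using (∈-map⁺; ∈-map⁻; ∈-concatMap⁺; ∈-concatMap⁻; ∈-filter⁺; ∈-filter⁻; ∈-cartesianProduct⁺; ∈-allFin)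
open import Data.List.Membership.Propositional.Properties.WithK using (unique∧set⇒bag)
open import Data.List.Properties using (map-cong; map-∘; map-tabulate)
open import Data.List.Relation.Binary.BagAndSetEquality using (∼bag⇒↭)
open import Data.List.Relation.Binary.Permutation.Propositional.Properties using (↭-length)
open import Data.List.Relation.Unary.All as All using (All; []; _∷_)
open import Data.List.Relation.Unary.All.Properties using (all⁺)
open import Data.List.Relation.Unary.AllPairs using ([]; _∷_)
open import Data.List.Relation.Unary.Any using (here; there)
open import Data.List.Relation.Unary.Any.Properties using (any⁺; any⁻)
open import Data.List.Relation.Unary.Unique.Propositional using (Unique)
import Data.List.Relation.Unary.Unique.Propositional.Properties as Unique
open import Data.Nat as ℕ using (ℕ; zero; suc; _≤_; _<_; _<?_; s≤s; z≤n; _≡ᵇ_; _⊓_; _∸_; ∣_-_∣)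
import Data.Nat.Properties as ℕ
open import Data.Product using (_×_; _,_; proj₁; proj₂; ∃; uncurry)
open import Data.Product.Properties using (,-injective)
open import Data.Rational as ℚ
  using (ℚ; 0ℚ; 1ℚ; _+_; _*_; _-_; _/_; nonNegative; positive; ≢-nonZero)
  renaming (_≤_ to _≤ℚ_; _<_ to _<ℚ_)
import Data.Rational.Properties as ℚ
open import Data.Sum as Sum using (_⊎_; inj₁; inj₂; [_,_]′)
open import Data.Unit using (tt)
import Data.Vec.Functional as Vec
open import Function using (_∘_; id; _⇔_; mk⇔; Equivalence)
open import Function.Definitions using (Injective)
open import Relation.Binary.PropositionalEquality
open import Relation.Nullary using (yes; no; ¬_)
open import Relation.Nullary.Decidable using (⌊_⌋; toWitness; fromWitness; from-yes)

open Equivalence using (to; from)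
open Algebra.Properties.CommutativeSemigroup
  (CommutativeMonoid.commutativeSemigroup ℚ.+-0-commutativeMonoid) using (interchange)
module +-Group = Algebra.Properties.AbelianGroup ℚ.+-0-abelianGroup

private
  variable
    A B : Set
    k m n : ℕ

T⇔T⇒≡ : {a b : Bool} → (T a → T b) → (T b → T a) → a ≡ b
T⇔T⇒≡ {false} {false} _ _ = refl
T⇔T⇒≡ {false} {true}  _ f = ⊥-elim (f tt)
T⇔T⇒≡ {true}  {false} f _ = ⊥-elim (f tt)
T⇔T⇒≡ {true}  {true}  _ _ = refl

-- Unification cannot see through T of a boolean that reduces, so these rules take the
-- left operand explicitly.
T-∧⁻ : ∀ a {b} → T (a ∧ b) → T a × T b
T-∧⁻ true  tb = tt , tb

T-∨⁻ : ∀ a {b} → T (a ∨ b) → T a ⊎ T b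
T-∨⁻ true  _  = inj₁ tt
T-∨⁻ false tb = inj₂ tb

∨-introʳ : ∀ a {b} → T b → T (a ∨ b)
∨-introʳ true  _  = tt
∨-introʳ false tb = tb

==⇒≡ : {p q : V n} → T (p == q) → p ≡ q
==⇒≡ {p = a , b} {c , d} t =
  let t₁ , t₂ = to T-∧ t in cong₂ _,_ (toWitness {a? = a Fin.≟ c} t₁) (toWitness {a? = b Fin.≟ d} t₂)

≟-diag : (a : Fin n) → T ⌊ a Fin.≟ a ⌋
≟-diag a = fromWitness {a? = a Fin.≟ a} refl

≡⇒== : {p q : V n} → p ≡ q → T (p == q)
≡⇒== {p = a , b} refl = from T-∧ (≟-diag a , ≟-diag b)

≠⇒≢ : {p q : V n} → T (p ≠ q) → p ≢ q
≠⇒≢ t p≡q = subst T (to T-not-≡ t) (≡⇒== p≡q)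

≢⇒≠ : {p q : V n} → p ≢ q → T (p ≠ q)
≢⇒≠ {p = p} {q} p≢q with p == q in eq
... | true  = p≢q (==⇒≡ (subst T (sym eq) tt))
... | false = tt

¬≠⇒≡ : {p q : V n} → ¬ T (p ≠ q) → p ≡ q
¬≠⇒≡ {p = p} {q} ¬p≠q with p == q in eq
... | true  = ==⇒≡ (subst T (sym eq) tt)
... | false = ⊥-elim (¬p≠q tt)

==-invariant : {f : V m → V n} → Injective _≡_ _≡_ f → ∀ p q → (f p == f q) ≡ (p == q)
==-invariant {f = f} f-inj p q =
  T⇔T⇒≡ (≡⇒== ∘ f-inj ∘ ==⇒≡) (≡⇒== ∘ cong f ∘ ==⇒≡)

module _ {m : ℕ} where

  csuc : Fin (suc m) → Fin (suc m)
  csuc j with toℕ j <? m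
  ... | yes j<m = fromℕ< (s≤s j<m)
  ... | no  _   = Fin.zero

  cpred : Fin (suc m) → Fin (suc m)
  cpred Fin.zero    = fromℕ m
  cpred (Fin.suc k) = inject₁ k

  <-or-top : (j : Fin (suc m)) → toℕ j < m ⊎ toℕ j ≡ m
  <-or-top j = ℕ.m≤n⇒m<n∨m≡n (Fin.toℕ≤pred[n] j)

  toℕ-csuc : (j : Fin (suc m)) → toℕ j < m → toℕ (csuc j) ≡ suc (toℕ j)
  toℕ-csuc j j<m with toℕ j <? m
  ... | yes j<m′ = Fin.toℕ-fromℕ< (s≤s j<m′)
  ... | no  j≮m  = ⊥-elim (j≮m j<m)

  csuc-top : (j : Fin (suc m)) → toℕ j ≡ m → csuc j ≡ Fin.zero
  csuc-top j j≡m with toℕ j <? m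
  ... | yes j<m = ⊥-elim (ℕ.<-irrefl j≡m j<m)
  ... | no  _   = refl

  csuc-cpred : (j : Fin (suc m)) → csuc (cpred j) ≡ j
  csuc-cpred Fin.zero = csuc-top (fromℕ m) (Fin.toℕ-fromℕ m)
  csuc-cpred (Fin.suc k) = Fin.toℕ-injective (begin
    toℕ (csuc (inject₁ k))  ≡⟨ toℕ-csuc (inject₁ k) (subst (_< m) (sym (Fin.toℕ-inject₁ k)) (Fin.toℕ<n k)) ⟩
    suc (toℕ (inject₁ k))   ≡⟨ cong suc (Fin.toℕ-inject₁ k) ⟩
    suc (toℕ k)             ∎)
    where open ≡-Reasoning

  csuc-injective : Injective _≡_ _≡_ csuc
  csuc-injective {i} {j} eq with <-or-top i | <-or-top j
  ... | inj₁ i<m | inj₁ j<m = Fin.toℕ-injective (ℕ.suc-injective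
        (trans (sym (toℕ-csuc i i<m)) (trans (cong toℕ eq) (toℕ-csuc j j<m))))
  ... | inj₁ i<m | inj₂ j≡m with () ← trans (sym (toℕ-csuc i i<m)) (cong toℕ (trans eq (csuc-top j j≡m)))
  ... | inj₂ i≡m | inj₁ j<m with () ← trans (sym (toℕ-csuc j j<m)) (cong toℕ (trans (sym eq) (csuc-top i i≡m)))
  ... | inj₂ i≡m | inj₂ j≡m = Fin.toℕ-injective (trans i≡m (sym j≡m))

  csuc≡⇒≡cpred : {i j : Fin (suc m)} → csuc i ≡ j → i ≡ cpred j
  csuc≡⇒≡cpred {j = j} eq = csuc-injective (trans eq (sym (csuc-cpred j)))

  csuc-≢ : 1 ≤ m → (j : Fin (suc m)) → csuc j ≢ j
  csuc-≢ 1≤m j eq with <-or-top j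
  ... | inj₁ j<m = ℕ.1+n≢n (trans (sym (toℕ-csuc j j<m)) (cong toℕ eq))
  ... | inj₂ j≡m = ℕ.<⇒≢ 1≤m (trans (sym (cong toℕ (trans (sym eq) (csuc-top j j≡m)))) j≡m)

  csuc²-≢ : 2 ≤ m → (j : Fin (suc m)) → csuc (csuc j) ≢ j
  csuc²-≢ 2≤m j eq with <-or-top j
  ... | inj₂ j≡m = ℕ.<⇒≢ 2≤m (sym (begin
    m                    ≡⟨ sym j≡m ⟩
    toℕ j                ≡⟨ cong toℕ (sym eq) ⟩
    toℕ (csuc (csuc j))  ≡⟨ cong (toℕ ∘ csuc) (csuc-top j j≡m) ⟩
    toℕ (csuc Fin.zero)  ≡⟨ toℕ-csuc Fin.zero (ℕ.<-trans (s≤s z≤n) 2≤m) ⟩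
    1                    ∎))
    where open ≡-Reasoning
  ... | inj₁ j<m with <-or-top (csuc j)
  ...   | inj₁ sj<m = ℕ.<⇒≢ (ℕ.<-trans (ℕ.n<1+n _) (ℕ.n<1+n _)) (sym (begin
    suc (suc (toℕ j))    ≡⟨ cong suc (toℕ-csuc j j<m) ⟨
    suc (toℕ (csuc j))   ≡⟨ toℕ-csuc (csuc j) sj<m ⟨
    toℕ (csuc (csuc j))  ≡⟨ cong toℕ eq ⟩
    toℕ j                ∎))
    where open ≡-Reasoning
  ...   | inj₂ sj≡m = ℕ.<⇒≢ 2≤m (sym (begin
    m                          ≡⟨ sym sj≡m ⟩
    toℕ (csuc j)               ≡⟨ toℕ-csuc j j<m ⟩
    suc (toℕ j)                ≡⟨ cong (suc ∘ toℕ) eq ⟨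
    suc (toℕ (csuc (csuc j)))  ≡⟨ cong (suc ∘ toℕ) (csuc-top (csuc j) sj≡m) ⟩
    1                          ∎))
    where open ≡-Reasoning

  isSuccMod-csuc : (j : Fin (suc m)) → T (isSuccMod (suc m) j (csuc j))
  isSuccMod-csuc j with <-or-top j
  ... | inj₁ j<m = from T-∨ (inj₁ (ℕ.≡⇒≡ᵇ _ _ (toℕ-csuc j j<m)))
  ... | inj₂ j≡m = from T-∨ (inj₂ (from T-∧ (ℕ.≡⇒≡ᵇ _ _ j≡m , ℕ.≡⇒≡ᵇ _ 0 (cong toℕ (csuc-top j j≡m)))))

  isSuccMod⇒csuc : {j j′ : Fin (suc m)} → T (isSuccMod (suc m) j j′) → j′ ≡ csuc j
  isSuccMod⇒csuc {j} {j′} t with to T-∨ t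
  ... | inj₁ next = Fin.toℕ-injective (trans j′≡1+j (sym (toℕ-csuc j j<m)))
    where
    j′≡1+j = ℕ.≡ᵇ⇒≡ (toℕ j′) (suc (toℕ j)) next
    j<m = ℕ.≤-pred (subst (_< suc m) j′≡1+j (Fin.toℕ<n j′))
  ... | inj₂ wrap = let top , bottom = to T-∧ wrap in
    trans (Fin.toℕ-injective (ℕ.≡ᵇ⇒≡ (toℕ j′) 0 bottom)) (sym (csuc-top j (ℕ.≡ᵇ⇒≡ (toℕ j) m top)))

  near : Fin (suc m) → Fin 3 → Fin (suc m)
  near c 0F = cpred c
  near c 1F = c
  near c 2F = csuc c

  near-injective : 2 ≤ m → (c : Fin (suc m)) → Injective _≡_ _≡_ (near c)
  near-injective 2≤m c {a} {b} = injective a b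
    where
    1≤m = ℕ.<⇒≤ 2≤m
    pred≢id : cpred c ≢ c
    pred≢id e = csuc-≢ 1≤m c (trans (cong csuc (sym e)) (csuc-cpred c))
    pred≢suc : cpred c ≢ csuc c
    pred≢suc e = csuc²-≢ 2≤m c (trans (cong csuc (sym e)) (csuc-cpred c))
    injective : ∀ a b → near c a ≡ near c b → a ≡ b
    injective 0F 0F _ = refl
    injective 0F 1F e = ⊥-elim (pred≢id e)
    injective 0F 2F e = ⊥-elim (pred≢suc e)
    injective 1F 0F e = ⊥-elim (pred≢id (sym e))
    injective 1F 1F _ = refl
    injective 1F 2F e = ⊥-elim (csuc-≢ 1≤m c (sym e))
    injective 2F 0F e = ⊥-elim (pred≢suc (sym e))
    injective 2F 1F e = ⊥-elim (csuc-≢ 1≤m c e)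
    injective 2F 2F _ = refl

window : V (suc m) → V 3 → V (suc m)
window (i , j) (a , b) = near i a , near j b

window-injective : 2 ≤ m → (u : V (suc m)) → Injective _≡_ _≡_ (window u)
window-injective 2≤m (i , j) eq = let eq₁ , eq₂ = ,-injective eq in
  cong₂ _,_ (near-injective 2≤m i eq₁) (near-injective 2≤m j eq₂)

data GridStep : Fin 3 → Fin 3 → Set where
  step₀₁ : GridStep 0F 1F
  step₁₂ : GridStep 1F 2F

data GridArc : V 3 → V 3 → Set where
  along₂ : ∀ x {a b} → GridStep a b → GridArc (x , a) (x , b)
  along₁ : ∀ y {a b} → GridStep a b → GridArc (a , y) (b , y)

GridEdge : V 3 → V 3 → Set
GridEdge p q = GridArc p q ⊎ GridArc q p

near-step : (c : Fin (suc m)) {a b : Fin 3} → GridStep a b → T (isSuccMod (suc m) (near c a) (near c b))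
near-step {m} c step₀₁ = subst (T ∘ isSuccMod (suc m) (cpred c)) (csuc-cpred c) (isSuccMod-csuc (cpred c))
near-step c step₁₂ = isSuccMod-csuc c

window-arc : (u : V (suc m)) {p q : V 3} → GridArc p q → T (torusArc (window u p) (window u q))
window-arc (i , j) (along₂ x s) = from T-∨ (inj₁ (from T-∧ (≟-diag (near i x) , near-step j s)))
window-arc (i , j) (along₁ y s) = from T-∨ (inj₂ (from T-∧ (near-step i s , ≟-diag (near j y))))

gridArc-≢ : {p q : V 3} → GridArc p q → p ≢ q
gridArc-≢ (along₂ x step₀₁) ()
gridArc-≢ (along₂ x step₁₂) ()
gridArc-≢ (along₁ y step₀₁) ()
gridArc-≢ (along₁ y step₁₂) ()

window-edge : 2 ≤ m → (u : V (suc m)) (c : V (suc m) → V (suc m)) {p q : V 3} →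
              GridEdge p q → T (edge c (window u p) (window u q))
window-edge 2≤m u c {p} {q} e = from T-∧ (≢⇒≠ (p≢q ∘ window-injective 2≤m u) , from T-∨ (inj₁ local))
  where
  p≢q : p ≢ q
  p≢q = [ gridArc-≢ , (λ a → gridArc-≢ a ∘ sym) ]′ e
  local : T (localEdge (window u p) (window u q))
  local = from T-∨ (Sum.map (window-arc u) (window-arc u) e)

∈-vertices : (p : V n) → p ∈ vertices n
∈-vertices (i , j) = ∈-cartesianProduct⁺ (∈-allFin i) (∈-allFin j)

any-∈ : (p : A → Bool) {x : A} {xs : List A} → x ∈ xs → T (p x) → T (any p xs)
any-∈ p x∈xs px = any⁺ p (lose x∈xs px)

-- Without function extensionality g need not itself occur in finFuns k xs, but
-- expand e g does for a suitable e : Fin 0 → A, and agrees with g definitionally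
-- at every numeral.
expand : (Fin 0 → A) → (Fin k → A) → Fin k → A
expand {k = zero}  e g = e
expand {k = suc k} e g = g Fin.zero Vec.∷ expand e (g ∘ Fin.suc)

expand-≗ : (e : Fin 0 → A) (g : Fin k → A) (i : Fin k) → expand e g i ≡ g i
expand-≗ e g Fin.zero    = refl
expand-≗ e g (Fin.suc i) = expand-≗ e (g ∘ Fin.suc) i

finFuns-complete : (xs : List A) (g : Fin k → A) → (∀ i → g i ∈ xs) →
                   ∃ λ e → expand e g ∈ finFuns k xs
finFuns-complete {k = zero}  xs g _   = _ , here refl
finFuns-complete {k = suc k} xs g g∈ =
  let e , tail∈ = finFuns-complete xs (g ∘ Fin.suc) (g∈ ∘ Fin.suc)
  in e , ∈-concatMap⁺ _ (lose (g∈ Fin.zero) (∈-map⁺ (g Fin.zero Vec.∷_) tail∈))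

finFuns-sound : (xs : List A) {g : Fin k → A} → g ∈ finFuns k xs → ∀ i → g i ∈ xs
finFuns-sound {k = suc k} xs g∈ i
  with x , x∈xs , g∈map ← find (∈-concatMap⁻ (λ x → map (x Vec.∷_) (finFuns k xs)) {xs = xs} g∈)
  with g′ , g′∈ , refl ← ∈-map⁻ (x Vec.∷_) g∈map
  with i
... | Fin.zero  = x∈xs
... | Fin.suc i = finFuns-sound xs g′∈ i

triples : (n : ℕ) → List (Cyc n)
triples n = cartesianProduct (vertices n) (cartesianProduct (vertices n) (vertices n))

∈-triples : (t : Cyc n) → t ∈ triples n
∈-triples (v₁ , v₂ , v₃) =
  ∈-cartesianProduct⁺ (∈-vertices v₁) (∈-cartesianProduct⁺ (∈-vertices v₂) (∈-vertices v₃))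

isCycle⇒∈cycles : (c : V n → V n) (u : V n) {t : Cyc n} → T (isCycle c u t) → t ∈ cycles c u
isCycle⇒∈cycles c u {t} = ∈-filter⁺ (T? ∘ isCycle c u) (∈-triples t)

∈cycles⇒isCycle : (c : V n → V n) (u : V n) {t : Cyc n} → t ∈ cycles c u → T (isCycle c u t)
∈cycles⇒isCycle {n} c u = proj₂ ∘ ∈-filter⁻ (T? ∘ isCycle c u) {xs = triples n}

-- latticeWitness and distinctCycles name, definitionally, the bodies of latticeOrdering
-- and of the filter in latticePatterns.
squareCondition : V n → Cyc n → Cyc n → V n → V n → V n → V n → Bool
squareCondition u Cₖ Cₖ₊₁ w aₖ₋₁ aₖ bₖ =
  cycHas u Cₖ w ∧ cycEdge u Cₖ w aₖ ∧ cycEdge u Cₖ₊₁ w aₖ ∧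
  (bₖ ≠ w) ∧ cycHas u Cₖ bₖ ∧ cycEdge u Cₖ bₖ aₖ₋₁ ∧ cycEdge u Cₖ bₖ aₖ

latticeWitness : V n → (Fin 4 → Cyc n) → V n → (Fin 4 → V n) → (Fin 4 → V n) → Bool
latticeWitness u C w a b =
  all (λ k → squareCondition u (C k) (C (next k)) w (a (prev k)) (a k) (b k)) (allFin 4) ∧
  all (λ k → all (λ l → ⌊ k Fin.≟ l ⌋ ∨ not (sameEdge w (a k) w (a l))) (allFin 4)) (allFin 4) ∧
  distinctList (w ∷ a 0F ∷ a 1F ∷ a 2F ∷ a 3F ∷ b 0F ∷ b 1F ∷ b 2F ∷ b 3F ∷ [])

distinctCycles : (Fin 4 → Cyc n) → Bool
distinctCycles C = all (λ k → all (λ l → ⌊ k Fin.≟ l ⌋ ∨ not (sameCycle (C k) (C l))) (allFin 4)) (allFin 4)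

latticePatterns-intro : (c : V n → V n) (u : V n) {C : Fin 4 → Cyc n} → C ∈ finFuns 4 (cycles c u) →
                        T (distinctCycles C) → T (latticeOrdering u C) → C ∈ latticePatterns c u
latticePatterns-intro c u C∈ distinct ordering =
  ∈-filter⁺ (T? ∘ λ C → distinctCycles C ∧ latticeOrdering u C) C∈ (from T-∧ (distinct , ordering))

latticePatterns-cycles : (c : V n → V n) (u : V n) {C : Fin 4 → Cyc n} → C ∈ latticePatterns c u →
                         ∀ k → C k ∈ cycles c u
latticePatterns-cycles c u C∈ =
  finFuns-sound (cycles c u) (proj₁ (∈-filter⁻ (T? ∘ λ C → distinctCycles C ∧ latticeOrdering u C) C∈))

inE''-intro : (c : V n → V n) (u x : V n) {C : Fin 4 → Cyc n} → C ∈ latticePatterns c u →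
              (k : Fin 4) → T (cycEdge u (C k) u x) → T (inE'' c u x)
inE''-intro c u x {C} C∈ k onEdge =
  any-∈ (λ C → any (λ k → cycEdge u (C k) u x) (allFin 4)) C∈
        (any-∈ (λ k → cycEdge u (C k) u x) (∈-allFin k) onEdge)

inE''-elim : (c : V n → V n) (u x : V n) → T (inE'' c u x) →
             ∃ λ C → C ∈ latticePatterns c u × ∃ λ k → T (cycEdge u (C k) u x)
inE''-elim c u x x∈E'' =
  let C , C∈ , onSome = find (any⁻ (λ C → any (λ k → cycEdge u (C k) u x) (allFin 4))
                                   (latticePatterns c u) x∈E'')
      k , _ , onEdge = find (any⁻ (λ k → cycEdge u (C k) u x) (allFin 4) onSome)
  in C , C∈ , k , onEdge

-- Proved once for abstract C: checking the same conversion for a concrete C makes the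
-- type checker evaluate the pattern.
latticeWitness-expand : (u : V n) (C : Fin 4 → Cyc n) (w : V n) (a b : Fin 4 → V n) (e : Fin 0 → Cyc n) →
                        latticeWitness u (expand e C) w a b ≡ latticeWitness u C w a b
latticeWitness-expand u C w a b e = refl

latticeOrdering-intro : (u : V n) (C : Fin 4 → Cyc n) (w : V n) (a b : Fin 4 → V n) →
                        T (latticeWitness u C w a b) → T (latticeOrdering u C)
latticeOrdering-intro {n} u C w a b witness =
  let eᵃ , a∈ = finFuns-complete (vertices n) a (∈-vertices ∘ a)
      eᵇ , b∈ = finFuns-complete (vertices n) b (∈-vertices ∘ b)
  in any-∈ _ (∈-vertices w) (any-∈ _ a∈ (any-∈ (latticeWitness u C w (expand eᵃ a)) b∈ witness))

all-cong : {p q : A → Bool} → (∀ x → p x ≡ q x) → (xs : List A) → all p xs ≡ all q xs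
all-cong p≗q xs = cong and (map-cong p≗q xs)

module Transport {m n} (f : V m → V n) (f-injective : Injective _≡_ _≡_ f) where

  mapCyc : Cyc m → Cyc n
  mapCyc (v₁ , v₂ , v₃) = f v₁ , f v₂ , f v₃

  ==-pres : ∀ p q → (f p == f q) ≡ (p == q)
  ==-pres = ==-invariant f-injective

  ≠-pres : ∀ p q → (f p ≠ f q) ≡ (p ≠ q)
  ≠-pres p q = cong not (==-pres p q)

  sameEdge-pres : ∀ p q x y → sameEdge (f p) (f q) (f x) (f y) ≡ sameEdge p q x y
  sameEdge-pres p q x y =
    cong₂ _∨_ (cong₂ _∧_ (==-pres p x) (==-pres q y)) (cong₂ _∧_ (==-pres p y) (==-pres q x))

  cycEdge-pres : ∀ u t p q → cycEdge (f u) (mapCyc t) (f p) (f q) ≡ cycEdge u t p q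
  cycEdge-pres u (v₁ , v₂ , v₃) p q =
    cong₂ _∨_ (sameEdge-pres p q u v₁) (cong₂ _∨_ (sameEdge-pres p q v₁ v₂)
      (cong₂ _∨_ (sameEdge-pres p q v₂ v₃) (sameEdge-pres p q v₃ u)))

  cycHas-pres : ∀ u t x → cycHas (f u) (mapCyc t) (f x) ≡ cycHas u t x
  cycHas-pres u (v₁ , v₂ , v₃) x =
    cong₂ _∨_ (==-pres x u) (cong₂ _∨_ (==-pres x v₁) (cong₂ _∨_ (==-pres x v₂) (==-pres x v₃)))

  sameCycle-pres : ∀ t t′ → sameCycle (mapCyc t) (mapCyc t′) ≡ sameCycle t t′
  sameCycle-pres (a , b , d) (a′ , b′ , d′) =
    cong₂ _∨_ (cong₂ _∧_ (==-pres a a′) (cong₂ _∧_ (==-pres b b′) (==-pres d d′)))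
              (cong₂ _∧_ (==-pres a d′) (cong₂ _∧_ (==-pres b b′) (==-pres d a′)))

  distinctList-pres : ∀ xs → distinctList (map f xs) ≡ distinctList xs
  distinctList-pres []       = refl
  distinctList-pres (x ∷ xs) =
    cong₂ _∧_ (trans (cong and (sym (map-∘ xs))) (all-cong (≠-pres x) xs)) (distinctList-pres xs)

  squareCondition-pres : ∀ u Cₖ Cₖ₊₁ w aₖ₋₁ aₖ bₖ →
    squareCondition (f u) (mapCyc Cₖ) (mapCyc Cₖ₊₁) (f w) (f aₖ₋₁) (f aₖ) (f bₖ) ≡
    squareCondition u Cₖ Cₖ₊₁ w aₖ₋₁ aₖ bₖ
  squareCondition-pres u Cₖ Cₖ₊₁ w aₖ₋₁ aₖ bₖ =
    cong₂ _∧_ (cycHas-pres u Cₖ w) (cong₂ _∧_ (cycEdge-pres u Cₖ w aₖ) (cong₂ _∧_ (cycEdge-pres u Cₖ₊₁ w aₖ)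
      (cong₂ _∧_ (≠-pres bₖ w) (cong₂ _∧_ (cycHas-pres u Cₖ bₖ)
        (cong₂ _∧_ (cycEdge-pres u Cₖ bₖ aₖ₋₁) (cycEdge-pres u Cₖ bₖ aₖ))))))

  latticeWitness-pres : ∀ u C w a b →
    latticeWitness (f u) (mapCyc ∘ C) (f w) (f ∘ a) (f ∘ b) ≡ latticeWitness u C w a b
  latticeWitness-pres u C w a b =
    cong₂ _∧_ (all-cong (λ k → squareCondition-pres u (C k) (C (next k)) w (a (prev k)) (a k) (b k)) (allFin 4))
      (cong₂ _∧_ (all-cong (λ k → all-cong (λ l → cong (λ s → ⌊ k Fin.≟ l ⌋ ∨ not s)
                                                      (sameEdge-pres w (a k) w (a l))) (allFin 4)) (allFin 4))
                 (distinctList-pres (w ∷ a 0F ∷ a 1F ∷ a 2F ∷ a 3F ∷ b 0F ∷ b 1F ∷ b 2F ∷ b 3F ∷ [])))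

  distinctCycles-pres : ∀ C → distinctCycles (mapCyc ∘ C) ≡ distinctCycles C
  distinctCycles-pres C = all-cong (λ k → all-cong (λ l → cong (λ s → ⌊ k Fin.≟ l ⌋ ∨ not s)
                                                     (sameCycle-pres (C k) (C l))) (allFin 4)) (allFin 4)

-- spoke k and corner k play the roles of a_k and b_k in the lattice pattern.
centre : V 3
centre = 1F , 1F

spoke corner : Fin 4 → V 3
spoke 0F = 1F , 2F
spoke 1F = 2F , 1F
spoke 2F = 1F , 0F
spoke 3F = 0F , 1F
corner 0F = 0F , 2F
corner 1F = 2F , 2F
corner 2F = 2F , 0F
corner 3F = 0F , 0F

square : Fin 4 → Cyc 3
square k = spoke (prev k) , corner k , spoke k

square-latticeWitness : T (latticeWitness centre square centre spoke corner)
square-latticeWitness = tt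

square-distinctCycles : T (distinctCycles square)
square-distinctCycles = tt

square-distinct : ∀ k → T (distinctList (centre ∷ spoke (prev k) ∷ corner k ∷ spoke k ∷ []))
square-distinct 0F = tt
square-distinct 1F = tt
square-distinct 2F = tt
square-distinct 3F = tt

square-grid : ∀ k → GridEdge centre (spoke (prev k)) × GridEdge (spoke (prev k)) (corner k) ×
                    GridEdge (corner k) (spoke k) × GridEdge (spoke k) centre
square-grid 0F = inj₂ (along₁ 1F step₀₁) , inj₁ (along₂ 0F step₁₂) ,
                 inj₁ (along₁ 2F step₀₁) , inj₂ (along₂ 1F step₁₂)
square-grid 1F = inj₁ (along₂ 1F step₁₂) , inj₁ (along₁ 2F step₁₂) ,
                 inj₂ (along₂ 2F step₁₂) , inj₂ (along₁ 1F step₁₂)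
square-grid 2F = inj₁ (along₁ 1F step₁₂) , inj₂ (along₂ 2F step₀₁) ,
                 inj₂ (along₁ 0F step₁₂) , inj₁ (along₂ 1F step₀₁)
square-grid 3F = inj₂ (along₂ 1F step₀₁) , inj₂ (along₁ 0F step₀₁) ,
                 inj₁ (along₂ 0F step₀₁) , inj₁ (along₁ 1F step₀₁)

cycEdge-root-last : (u : V n) (t : Cyc n) → T (cycEdge u t u (proj₂ (proj₂ t)))
cycEdge-root-last u (v₁ , v₂ , v₃) =
  ∨-introʳ (sameEdge u v₃ u v₁) (∨-introʳ (sameEdge u v₃ v₁ v₂) (∨-introʳ (sameEdge u v₃ v₂ v₃)
    (∨-introʳ ((u == v₃) ∧ (v₃ == u)) (from T-∧ (≡⇒== {p = u} refl , ≡⇒== {p = v₃} refl)))))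

neighbour : V (suc m) → Fin 4 → V (suc m)
neighbour u = window u ∘ spoke

module LatticeAt {m} (2≤m : 2 ≤ m) (u : V (suc m)) (c : V (suc m) → V (suc m)) where

  open Transport (window u) (window-injective 2≤m u)

  latticeSquare : Fin 4 → Cyc (suc m)
  latticeSquare = mapCyc ∘ square

  latticeSquare-isCycle : ∀ k → T (isCycle c u (latticeSquare k))
  latticeSquare-isCycle k with square-grid k
  ... | e₁ , e₂ , e₃ , e₄ =
    from T-∧ (subst T (sym (distinctList-pres (centre ∷ spoke (prev k) ∷ corner k ∷ spoke k ∷ [])))
                        (square-distinct k) ,
              from T-∧ (grid⇒edge e₁ , from T-∧ (grid⇒edge e₂ , from T-∧ (grid⇒edge e₃ , grid⇒edge e₄))))
    where grid⇒edge = window-edge 2≤m u c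

  latticeSquare-pattern : ∃ λ e → expand e latticeSquare ∈ latticePatterns c u
  latticeSquare-pattern =
    let e , C∈ = finFuns-complete (cycles c u) latticeSquare (isCycle⇒∈cycles c u ∘ latticeSquare-isCycle)
    in e , latticePatterns-intro c u C∈ distinct (ordering e)
    where
    distinct : T (distinctCycles latticeSquare)
    distinct = subst T (sym (distinctCycles-pres square)) square-distinctCycles
    witness : T (latticeWitness u latticeSquare u (window u ∘ spoke) (window u ∘ corner))
    witness = subst T (sym (latticeWitness-pres centre square centre spoke corner)) square-latticeWitness
    ordering : ∀ e → T (latticeOrdering u (expand e latticeSquare))
    ordering e = latticeOrdering-intro u (expand e latticeSquare) u (window u ∘ spoke) (window u ∘ corner)
      (subst T (sym (latticeWitness-expand u latticeSquare u (window u ∘ spoke) (window u ∘ corner) e))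
               witness)

  neighbour-∈E'' : ∀ k → T (inE'' c u (neighbour u k))
  neighbour-∈E'' k =
    let e , pattern∈ = latticeSquare-pattern
    in inE''-intro c u (neighbour u k) pattern∈ k
         (subst (λ t → T (cycEdge u t u (neighbour u k))) (sym (expand-≗ e latticeSquare k))
                (cycEdge-root-last u (latticeSquare k)))

-- hasLongCycle u c is definitionally any (hasLongEdge c u) (cycles c u).
hasLongEdge : (V n → V n) → V n → Cyc n → Bool
hasLongEdge c u (v₁ , v₂ , v₃) = longEdge c u v₁ ∨ longEdge c v₁ v₂ ∨ longEdge c v₂ v₃ ∨ longEdge c v₃ u

sameEdge⇒ : (p q x y : V n) → T (sameEdge p q x y) → (p ≡ x × q ≡ y) ⊎ (p ≡ y × q ≡ x)
sameEdge⇒ p q x y t = Sum.map both both (T-∨⁻ ((p == x) ∧ (q == y)) t)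
  where
  both : {a b c d : V _} → T ((a == b) ∧ (c == d)) → a ≡ b × c ≡ d
  both t = let t₁ , t₂ = to T-∧ t in ==⇒≡ t₁ , ==⇒≡ t₂

cycEdge-root : (u x v₁ v₂ v₃ : V n) → All (u ≢_) (v₁ ∷ v₂ ∷ v₃ ∷ []) →
               T (cycEdge u (v₁ , v₂ , v₃) u x) → x ≡ v₁ ⊎ x ≡ v₃
cycEdge-root u x v₁ v₂ v₃ (u≢v₁ ∷ u≢v₂ ∷ u≢v₃ ∷ []) t with T-∨⁻ (sameEdge u x u v₁) t
... | inj₁ e₁ = Sum.map proj₂ (⊥-elim ∘ u≢v₁ ∘ proj₁) (sameEdge⇒ u x u v₁ e₁)
... | inj₂ t′ with T-∨⁻ (sameEdge u x v₁ v₂) t′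
...   | inj₁ e₂ = ⊥-elim ([ u≢v₁ ∘ proj₁ , u≢v₂ ∘ proj₁ ]′ (sameEdge⇒ u x v₁ v₂ e₂))
...   | inj₂ t″ with T-∨⁻ (sameEdge u x v₂ v₃) t″
...     | inj₁ e₃ = ⊥-elim ([ u≢v₂ ∘ proj₁ , u≢v₃ ∘ proj₁ ]′ (sameEdge⇒ u x v₂ v₃ e₃))
...     | inj₂ e₄ = Sum.map (⊥-elim ∘ u≢v₃ ∘ proj₁) proj₂ (sameEdge⇒ u x v₃ u e₄)

isCycle-root : (c : V n → V n) (u v₁ v₂ v₃ : V n) → T (isCycle c u (v₁ , v₂ , v₃)) →
               All (u ≢_) (v₁ ∷ v₂ ∷ v₃ ∷ []) × T (edge c u v₁) × T (edge c v₃ u)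
isCycle-root c u v₁ v₂ v₃ t =
  let distinct , edges = T-∧⁻ (distinctList (u ∷ v₁ ∷ v₂ ∷ v₃ ∷ [])) t
      fresh , _ = T-∧⁻ (all (u ≠_) (v₁ ∷ v₂ ∷ v₃ ∷ [])) distinct
      e₁ , edges′ = T-∧⁻ (edge c u v₁) edges
      _ , edges″ = T-∧⁻ (edge c v₁ v₂) edges′
      _ , e₄ = T-∧⁻ (edge c v₂ v₃) edges″
  in All.map ≠⇒≢ (all⁺ (u ≠_) (v₁ ∷ v₂ ∷ v₃ ∷ []) fresh) , e₁ , e₄

edge∧¬long⇒local : (c : V n → V n) (p q : V n) → T (edge c p q) → ¬ T (longEdge c p q) → T (localEdge p q)
edge∧¬long⇒local c p q e ¬long with localEdge p q
... | true  = tt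
... | false = ¬long (from T-∧ (e , tt))

localEdge-sym : (p q : V n) → T (localEdge p q) → T (localEdge q p)
localEdge-sym p q t = from T-∨ (Sum.swap (T-∨⁻ (torusArc p q) t))

cycle-root-local : (c : V n → V n) (u x : V n) (t : Cyc n) → T (isCycle c u t) →
                   ¬ T (hasLongEdge c u t) → T (cycEdge u t u x) → T (localEdge u x)
cycle-root-local c u x (v₁ , v₂ , v₃) isCyc ¬long onEdge
  with fresh , e₁ , e₄ ← isCycle-root c u v₁ v₂ v₃ isCyc
  with cycEdge-root u x v₁ v₂ v₃ fresh onEdge
... | inj₁ refl = edge∧¬long⇒local c u v₁ e₁ (¬long ∘ from T-∨ ∘ inj₁)
... | inj₂ refl = localEdge-sym v₃ u (edge∧¬long⇒local c v₃ u e₄ (¬long ∘ last))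
  where
  last : T (longEdge c v₃ u) → T (hasLongEdge c u (v₁ , v₂ , v₃))
  last = ∨-introʳ (longEdge c u v₁) ∘ ∨-introʳ (longEdge c v₁ v₂) ∘ ∨-introʳ (longEdge c v₂ v₃)

E''⊆local : (c : V n → V n) (u x : V n) → ¬ T (hasLongCycle u c) → T (inE'' c u x) → T (localEdge u x)
E''⊆local c u x noLong x∈E'' =
  let C , C∈ , k , onEdge = inE''-elim c u x x∈E''
      Cₖ∈ = latticePatterns-cycles c u C∈ k
  in cycle-root-local c u x (C k) (∈cycles⇒isCycle c u Cₖ∈) (noLong ∘ any-∈ (hasLongEdge c u) Cₖ∈) onEdge

length-filter-unique : {p : A → Bool} {xs ys : List A} → Unique xs → Unique ys →
                (∀ {x} → (x ∈ xs × T (p x)) ⇔ x ∈ ys) → length (filterᵇ p xs) ≡ length ys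
length-filter-unique {p = p} xs! ys! equiv =
  ↭-length (∼bag⇒↭ (unique∧set⇒bag (Unique.filter⁺ (T? ∘ p) xs!) ys!
    (mk⇔ (to equiv ∘ ∈-filter⁻ (T? ∘ p)) (uncurry (∈-filter⁺ (T? ∘ p)) ∘ from equiv))))

vertices-unique : (n : ℕ) → Unique (vertices n)
vertices-unique n = Unique.cartesianProduct⁺ (Unique.allFin⁺ n) (Unique.allFin⁺ n)

local⇒neighbour : (u x : V (suc m)) → T (localEdge u x) → ∃ λ k → x ≡ neighbour u k
local⇒neighbour {m} (i , j) (i′ , j′) t with T-∨⁻ (torusArc (i , j) (i′ , j′)) t
... | inj₁ arc with T-∨⁻ (⌊ i Fin.≟ i′ ⌋ ∧ isSuccMod (suc m) j j′) arc
...   | inj₁ a = let same , succ = T-∧⁻ ⌊ i Fin.≟ i′ ⌋ a in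
  0F , cong₂ _,_ (sym (toWitness same)) (isSuccMod⇒csuc succ)
...   | inj₂ a = let succ , same = T-∧⁻ (isSuccMod (suc m) i i′) a in
  1F , cong₂ _,_ (isSuccMod⇒csuc succ) (sym (toWitness same))
local⇒neighbour {m} (i , j) (i′ , j′) t | inj₂ arc with T-∨⁻ (⌊ i′ Fin.≟ i ⌋ ∧ isSuccMod (suc m) j′ j) arc
...   | inj₁ a = let same , succ = T-∧⁻ ⌊ i′ Fin.≟ i ⌋ a in
  2F , cong₂ _,_ (toWitness same) (csuc≡⇒≡cpred {j = j} (sym (isSuccMod⇒csuc succ)))
...   | inj₂ a = let succ , same = T-∧⁻ (isSuccMod (suc m) i′ i) a in
  3F , cong₂ _,_ (csuc≡⇒≡cpred {j = i} (sym (isSuccMod⇒csuc succ))) (toWitness same)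

-- Stated for arbitrary n: at n = suc m the type checker would start evaluating the
-- enumeration hidden in detected.
detected-intro : (u : V n) (c : V n → V n) →
                 length (filterᵇ (λ x → (x ≠ u) ∧ inE'' c u x) (vertices n)) ≡ 4 → T (detected u c)
detected-intro u c length≡4 = subst (T ∘ (_≡ᵇ 4)) (sym length≡4) tt

neighbours : V (suc m) → List (V (suc m))
neighbours u = map (neighbour u) (allFin 4)

spokes-unique : Unique (map spoke (allFin 4))
spokes-unique = ((λ ()) ∷ (λ ()) ∷ (λ ()) ∷ []) ∷ ((λ ()) ∷ (λ ()) ∷ []) ∷ ((λ ()) ∷ []) ∷ [] ∷ []

spoke≢centre : ∀ k → spoke k ≢ centre
spoke≢centre 0F ()
spoke≢centre 1F ()
spoke≢centre 2F ()
spoke≢centre 3F ()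

module _ {m} (2≤m : 2 ≤ m) (u : V (suc m)) (c : V (suc m) → V (suc m)) where

  open LatticeAt 2≤m u c using (neighbour-∈E'')

  neighbour≠centre : ∀ k → T (neighbour u k ≠ u)
  neighbour≠centre k = ≢⇒≠ (spoke≢centre k ∘ window-injective 2≤m u {spoke k} {centre})

  E''⇔neighbours : ¬ T (hasLongCycle u c) →
                   ∀ {x} → (x ∈ vertices (suc m) × T ((x ≠ u) ∧ inE'' c u x)) ⇔ x ∈ neighbours u
  E''⇔neighbours noLong {x} = mk⇔ ⇒ ⇐
    where
    ⇒ : x ∈ vertices (suc m) × T ((x ≠ u) ∧ inE'' c u x) → x ∈ neighbours u
    ⇒ (_ , t) =
      let k , x≡ = local⇒neighbour u x (E''⊆local c u x noLong (proj₂ (T-∧⁻ (x ≠ u) t)))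
      in subst (_∈ neighbours u) (sym x≡) (∈-map⁺ (neighbour u) (∈-allFin k))
    ⇐ : x ∈ neighbours u → x ∈ vertices (suc m) × T ((x ≠ u) ∧ inE'' c u x)
    ⇐ x∈ =
      let k , _ , x≡ = ∈-map⁻ (neighbour u) {xs = allFin 4} x∈
      in ∈-vertices x , subst (λ y → T ((y ≠ u) ∧ inE'' c u y)) (sym x≡)
                          (from (T-∧ {neighbour u k ≠ u}) (neighbour≠centre k , neighbour-∈E'' k))

  noLongCycle⇒detected : ¬ T (hasLongCycle u c) → T (detected u c)
  noLongCycle⇒detected noLong = detected-intro u c length≡4
    where
    length≡4 : length (filterᵇ (λ x → (x ≠ u) ∧ inE'' c u x) (vertices (suc m))) ≡ 4
    length≡4 = length-filter-unique {p = λ x → (x ≠ u) ∧ inE'' c u x} {vertices (suc m)} {neighbours u}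
                 (vertices-unique (suc m))
                 (Unique.map⁺ (window-injective 2≤m u) spokes-unique) (E''⇔neighbours noLong)

∑ ∏ : List A → (A → ℚ) → ℚ
∑ xs f = sumℚ (map f xs)
∏ xs f = prodℚ (map f xs)

∑-cong : (xs : List A) {f g : A → ℚ} → (∀ x → f x ≡ g x) → ∑ xs f ≡ ∑ xs g
∑-cong xs f≗g = cong sumℚ (map-cong f≗g xs)

∑-map : (xs : List A) (g : A → B) (f : B → ℚ) → ∑ (map g xs) f ≡ ∑ xs (f ∘ g)
∑-map xs g f = cong sumℚ (sym (map-∘ xs))

∏-map : (xs : List A) (g : A → B) (f : B → ℚ) → ∏ (map g xs) f ≡ ∏ xs (f ∘ g)
∏-map xs g f = cong prodℚ (sym (map-∘ xs))

∑-++ : (xs ys : List A) (f : A → ℚ) → ∑ (xs ++ ys) f ≡ ∑ xs f + ∑ ys f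
∑-++ []       ys f = sym (ℚ.+-identityˡ _)
∑-++ (x ∷ xs) ys f = trans (cong (_+_ (f x)) (∑-++ xs ys f)) (sym (ℚ.+-assoc (f x) _ _))

∏-++ : (xs ys : List A) (f : A → ℚ) → ∏ (xs ++ ys) f ≡ ∏ xs f * ∏ ys f
∏-++ []       ys f = sym (ℚ.*-identityˡ _)
∏-++ (x ∷ xs) ys f = trans (cong (f x *_) (∏-++ xs ys f)) (sym (ℚ.*-assoc (f x) _ _))

∑-concatMap : (xs : List A) (g : A → List B) (f : B → ℚ) → ∑ (concatMap g xs) f ≡ ∑ xs (λ x → ∑ (g x) f)
∑-concatMap []       g f = refl
∑-concatMap (x ∷ xs) g f = trans (∑-++ (g x) (concatMap g xs) f) (cong (_+_ (∑ (g x) f)) (∑-concatMap xs g f))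

∏-cartesianProduct : (xs : List A) (ys : List B) (f : A × B → ℚ) →
                     ∏ (cartesianProduct xs ys) f ≡ ∏ xs (λ x → ∏ ys (λ y → f (x , y)))
∏-cartesianProduct []       ys f = refl
∏-cartesianProduct (x ∷ xs) ys f =
  trans (∏-++ (map (x ,_) ys) (cartesianProduct xs ys) f)
        (cong₂ _*_ (∏-map ys (x ,_) f) (∏-cartesianProduct xs ys f))

∏-allFin-suc : (k : ℕ) (f : Fin (suc k) → ℚ) → ∏ (allFin (suc k)) f ≡ f Fin.zero * ∏ (allFin k) (f ∘ Fin.suc)
∏-allFin-suc k f =
  cong (λ fs → f Fin.zero * prodℚ fs) (trans (map-tabulate Fin.suc f) (sym (map-tabulate id (f ∘ Fin.suc))))

∏-one : (xs : List A) {f : A → ℚ} → (∀ x → f x ≡ 1ℚ) → ∏ xs f ≡ 1ℚ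
∏-one []       f≡1 = refl
∏-one (x ∷ xs) f≡1 = trans (cong₂ _*_ (f≡1 x) (∏-one xs f≡1)) (ℚ.*-identityˡ 1ℚ)

∑-*ˡ : (xs : List A) (a : ℚ) (f : A → ℚ) → ∑ xs (λ x → a * f x) ≡ a * ∑ xs f
∑-*ˡ []       a f = sym (ℚ.*-zeroʳ a)
∑-*ˡ (x ∷ xs) a f = trans (cong (_+_ (a * f x)) (∑-*ˡ xs a f)) (sym (ℚ.*-distribˡ-+ a (f x) _))

∑-*ʳ : (xs : List A) (a : ℚ) (f : A → ℚ) → ∑ xs (λ x → f x * a) ≡ ∑ xs f * a
∑-*ʳ []       a f = sym (ℚ.*-zeroˡ a)
∑-*ʳ (x ∷ xs) a f = trans (cong (_+_ (f x * a)) (∑-*ʳ xs a f)) (sym (ℚ.*-distribʳ-+ a (f x) _))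

∑-+ : (xs : List A) (f g : A → ℚ) → ∑ xs (λ x → f x + g x) ≡ ∑ xs f + ∑ xs g
∑-+ []       f g = refl
∑-+ (x ∷ xs) f g = trans (cong (_+_ (f x + g x)) (∑-+ xs f g)) (interchange (f x) (g x) (∑ xs f) (∑ xs g))

∑-finFuns-∏ : (k : ℕ) (xs : List A) (h : Fin k → A → ℚ) →
              ∑ (finFuns k xs) (λ g → ∏ (allFin k) (λ i → h i (g i))) ≡ ∏ (allFin k) (λ i → ∑ xs (h i))
∑-finFuns-∏ zero    xs h = refl
∑-finFuns-∏ (suc k) xs h = begin
  ∑ (finFuns (suc k) xs) (λ g → ∏ (allFin (suc k)) (λ i → h i (g i)))
    ≡⟨ ∑-concatMap xs (λ x → map (x Vec.∷_) (finFuns k xs)) _ ⟩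
  ∑ xs (λ x → ∑ (map (x Vec.∷_) (finFuns k xs)) (λ g → ∏ (allFin (suc k)) (λ i → h i (g i))))
    ≡⟨ ∑-cong xs (λ x → ∑-map (finFuns k xs) (x Vec.∷_) _) ⟩
  ∑ xs (λ x → ∑ (finFuns k xs) (λ g → ∏ (allFin (suc k)) (λ i → h i ((x Vec.∷ g) i))))
    ≡⟨ ∑-cong xs (λ x → ∑-cong (finFuns k xs) (λ g → ∏-allFin-suc k (λ i → h i ((x Vec.∷ g) i)))) ⟩
  ∑ xs (λ x → ∑ (finFuns k xs) (λ g → h Fin.zero x * rest g))
    ≡⟨ ∑-cong xs (λ x → ∑-*ˡ (finFuns k xs) (h Fin.zero x) rest) ⟩
  ∑ xs (λ x → h Fin.zero x * ∑ (finFuns k xs) rest)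
    ≡⟨ ∑-*ʳ xs (∑ (finFuns k xs) rest) (h Fin.zero) ⟩
  ∑ xs (h Fin.zero) * ∑ (finFuns k xs) rest
    ≡⟨ cong (∑ xs (h Fin.zero) *_) (∑-finFuns-∏ k xs (h ∘ Fin.suc)) ⟩
  ∑ xs (h Fin.zero) * ∏ (allFin k) (λ i → ∑ xs (h (Fin.suc i)))
    ≡⟨ ∏-allFin-suc k (λ i → ∑ xs (h i)) ⟨
  ∏ (allFin (suc k)) (λ i → ∑ xs (h i)) ∎
  where
  open ≡-Reasoning
  rest : (Fin k → _) → ℚ
  rest g = ∏ (allFin k) (λ i → h (Fin.suc i) (g i))

∑-filter : (xs : List A) (p : A → Bool) (f : A → ℚ) → (∀ x → ¬ T (p x) → f x ≡ 0ℚ) →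
           ∑ (filterᵇ p xs) f ≡ ∑ xs f
∑-filter []       p f vanish = refl
∑-filter (x ∷ xs) p f vanish with p x in px
... | true  = cong (_+_ (f x)) (∑-filter xs p f vanish)
... | false = begin
  ∑ (filterᵇ p xs) f       ≡⟨ ∑-filter xs p f vanish ⟩
  ∑ xs f                   ≡⟨ ℚ.+-identityˡ _ ⟨
  0ℚ + ∑ xs f              ≡⟨ cong (_+ ∑ xs f) (vanish x (λ t → subst T px t)) ⟨
  f x + ∑ xs f             ∎
  where open ≡-Reasoning

∑-nonNeg : (xs : List A) {f : A → ℚ} → (∀ x → 0ℚ ≤ℚ f x) → 0ℚ ≤ℚ ∑ xs f
∑-nonNeg []       f≥0 = ℚ.≤-refl
∑-nonNeg (x ∷ xs) f≥0 = ℚ.+-mono-≤ (f≥0 x) (∑-nonNeg xs f≥0)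

*-nonNeg : {p q : ℚ} → 0ℚ ≤ℚ p → 0ℚ ≤ℚ q → 0ℚ ≤ℚ p * q
*-nonNeg {p} {q} p≥0 q≥0 =
  ℚ.nonNegative⁻¹ _ {{ℚ.nonNeg*nonNeg⇒nonNeg p {{nonNegative p≥0}} q {{nonNegative q≥0}}}}

∏-nonNeg : (xs : List A) {f : A → ℚ} → (∀ x → 0ℚ ≤ℚ f x) → 0ℚ ≤ℚ ∏ xs f
∏-nonNeg []       f≥0 = ℚ.nonNegative⁻¹ 1ℚ
∏-nonNeg (x ∷ xs) f≥0 = *-nonNeg (f≥0 x) (∏-nonNeg xs f≥0)

∑-mono-≤ : (xs : List A) {f g : A → ℚ} → (∀ x → f x ≤ℚ g x) → ∑ xs f ≤ℚ ∑ xs g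
∑-mono-≤ []       f≤g = ℚ.≤-refl
∑-mono-≤ (x ∷ xs) f≤g = ℚ.+-mono-≤ (f≤g x) (∑-mono-≤ xs f≤g)

∑-≥-term : {xs : List A} {f : A → ℚ} {x : A} → (∀ y → 0ℚ ≤ℚ f y) → x ∈ xs → f x ≤ℚ ∑ xs f
∑-≥-term {xs = y ∷ xs} {f} f≥0 (here refl) =
  subst (_≤ℚ f y + ∑ xs f) (ℚ.+-identityʳ (f y)) (ℚ.+-monoʳ-≤ (f y) (∑-nonNeg xs f≥0))
∑-≥-term {xs = y ∷ xs} {f} f≥0 (there x∈xs) =
  ℚ.≤-trans (∑-≥-term f≥0 x∈xs)
            (subst (_≤ℚ f y + ∑ xs f) (ℚ.+-identityˡ (∑ xs f)) (ℚ.+-monoˡ-≤ (∑ xs f) (f≥0 y)))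

module _ {Ω : Set} (xs : List Ω) (w : Ω → ℚ) where

  mass : (Ω → Bool) → ℚ
  mass E = ∑ xs (λ x → if E x then w x else 0ℚ)

  mass-nonNeg : (∀ x → 0ℚ ≤ℚ w x) → (E : Ω → Bool) → 0ℚ ≤ℚ mass E
  mass-nonNeg w≥0 E = ∑-nonNeg xs (λ x → restricted (E x) (w≥0 x))
    where
    restricted : ∀ b {p} → 0ℚ ≤ℚ p → 0ℚ ≤ℚ (if b then p else 0ℚ)
    restricted true  p≥0 = p≥0
    restricted false _   = ℚ.≤-refl

  mass-mono : (∀ x → 0ℚ ≤ℚ w x) → {E D : Ω → Bool} → (∀ x → T (E x) → T (D x)) → mass E ≤ℚ mass D
  mass-mono w≥0 {E} {D} E⊆D = ∑-mono-≤ xs (λ x → restricted (E x) (D x) (E⊆D x) (w≥0 x))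
    where
    restricted : ∀ e d {p} → (T e → T d) → 0ℚ ≤ℚ p → (if e then p else 0ℚ) ≤ℚ (if d then p else 0ℚ)
    restricted true  true  _   _   = ℚ.≤-refl
    restricted true  false e⇒d _   = ⊥-elim (e⇒d tt)
    restricted false true  _   p≥0 = p≥0
    restricted false false _   _   = ℚ.≤-refl

  mass-complement : (E : Ω → Bool) → mass E + mass (not ∘ E) ≡ ∑ xs w
  mass-complement E = trans (sym (∑-+ xs _ _)) (∑-cong xs (λ x → split (E x)))
    where
    split : ∀ b {p} → (if b then p else 0ℚ) + (if not b then p else 0ℚ) ≡ p
    split true  = ℚ.+-identityʳ _
    split false = ℚ.+-identityˡ _

  complement-≤ : (∀ x → 0ℚ ≤ℚ w x) → ∑ xs w ≡ 1ℚ → {E D : Ω → Bool} →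
                 (∀ x → ¬ T (E x) → T (D x)) → 1ℚ - mass E ≤ℚ mass D
  complement-≤ w≥0 total {E} {D} ¬E⇒D = subst (_≤ℚ mass D) (sym 1-mass) (mass-mono w≥0 not-E⇒D)
    where
    not-E⇒D : ∀ x → T (not (E x)) → T (D x)
    not-E⇒D x with E x in eq
    ... | true  = λ ()
    ... | false = λ _ → ¬E⇒D x (λ t → subst T eq t)
    1-mass : 1ℚ - mass E ≡ mass (not ∘ E)
    1-mass = begin
      1ℚ - mass E                            ≡⟨ cong (_- mass E) (trans (sym total) (sym (mass-complement E))) ⟩
      mass E + mass (not ∘ E) - mass E       ≡⟨ +-Group.xyx⁻¹≈y (mass E) (mass (not ∘ E)) ⟩
      mass (not ∘ E)                         ∎
      where open ≡-Reasoning

invSq-nonNeg : ∀ d → 0ℚ ≤ℚ invSq d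
invSq-nonNeg zero    = ℚ.≤-refl
invSq-nonNeg (suc k) = ℚ.nonNegative⁻¹ _ {{ℚ.normalize-nonNeg 1 (suc k ℕ.* suc k)}}

invSq-pos : ∀ d → d ≢ 0 → 0ℚ <ℚ invSq d
invSq-pos zero    d≢0 = ⊥-elim (d≢0 refl)
invSq-pos (suc k) _   = ℚ.positive⁻¹ _ {{ℚ.normalize-pos 1 (suc k ℕ.* suc k)}}

recip-inverseˡ : (S : ℚ) → 0ℚ <ℚ S → recip S * S ≡ 1ℚ
recip-inverseˡ S S>0 with S ℚ.≟ 0ℚ
... | yes S≡0 = ⊥-elim (ℚ.<⇒≢ S>0 (sym S≡0))
... | no  S≢0 = ℚ.*-inverseˡ S {{≢-nonZero S≢0}}

recip-nonNeg : (S : ℚ) → 0ℚ <ℚ S → 0ℚ ≤ℚ recip S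
recip-nonNeg S S>0 with S ℚ.≟ 0ℚ
... | yes S≡0 = ℚ.≤-refl
... | no  S≢0 = ℚ.<⇒≤ (ℚ.positive⁻¹ _ {{ℚ.1/pos⇒pos S {{positive S>0}}}})

cdist≡0⇒≡ : ∀ n a b → a ℕ.< n → b ℕ.< n → cdist n a b ≡ 0 → a ≡ b
cdist≡0⇒≡ n a b a<n b<n eq with ℕ.⊓-sel ∣ a - b ∣ (n ∸ ∣ a - b ∣)
... | inj₁ ⊓≡∣a-b∣ = ℕ.∣m-n∣≡0⇒m≡n (trans (sym ⊓≡∣a-b∣) eq)
... | inj₂ ⊓≡n∸∣a-b∣ = ⊥-elim (ℕ.<⇒≱ ∣a-b∣<n (ℕ.m∸n≡0⇒m≤n (trans (sym ⊓≡n∸∣a-b∣) eq)))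
  where ∣a-b∣<n = ℕ.≤-<-trans (ℕ.∣m-n∣≤m⊔n a b) (ℕ.⊔-lub a<n b<n)

dist≡0⇒≡ : (x w : V n) → dist x w ≡ 0 → w ≡ x
dist≡0⇒≡ {n} (a , b) (c , d) eq = cong₂ _,_
  (sym (Fin.toℕ-injective (cdist≡0⇒≡ n (toℕ a) (toℕ c) (Fin.toℕ<n a) (Fin.toℕ<n c) (ℕ.m+n≡0⇒m≡0 _ eq))))
  (sym (Fin.toℕ-injective (cdist≡0⇒≡ n (toℕ b) (toℕ d) (Fin.toℕ<n b) (Fin.toℕ<n d) (ℕ.m+n≡0⇒n≡0 _ eq))))

dist-self : (x : V n) → dist x x ≡ 0
dist-self {n} (a , b) = cong₂ ℕ._+_ (cong (λ z → z ⊓ (n ∸ z)) (ℕ.∣n-n∣≡0 (toℕ a)))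
                                    (cong (λ z → z ⊓ (n ∸ z)) (ℕ.∣n-n∣≡0 (toℕ b)))

module _ {m : ℕ} (1≤m : 1 ℕ.≤ m) where

  invSqSum : V (suc m) → ℚ
  invSqSum x = ∑ (filterᵇ (_≠ x) (vertices (suc m))) (invSq ∘ dist x)

  invSqSum-pos : (x : V (suc m)) → 0ℚ <ℚ invSqSum x
  invSqSum-pos x@(i , j) = ℚ.<-≤-trans (invSq-pos (dist x w) (w≢x ∘ dist≡0⇒≡ x w))
    (∑-≥-term (invSq-nonNeg ∘ dist x) (∈-filter⁺ (T? ∘ (_≠ x)) (∈-vertices w) (≢⇒≠ w≢x)))
    where
    w = i , csuc j
    w≢x : w ≢ x
    w≢x = csuc-≢ 1≤m j ∘ cong proj₂

  choice : V (suc m) → V (suc m) → ℚ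
  choice x v = Z x * invSq (dist x v)

  choice-nonNeg : ∀ x v → 0ℚ ≤ℚ choice x v
  choice-nonNeg x v = *-nonNeg (recip-nonNeg (invSqSum x) (invSqSum-pos x)) (invSq-nonNeg (dist x v))

  choice-mass : (x : V (suc m)) → ∑ (vertices (suc m)) (choice x) ≡ 1ℚ
  choice-mass x = begin
    ∑ (vertices (suc m)) (λ v → Z x * invSq (dist x v))
      ≡⟨ ∑-*ˡ (vertices (suc m)) (Z x) (invSq ∘ dist x) ⟩
    Z x * ∑ (vertices (suc m)) (invSq ∘ dist x)
      ≡⟨ cong (Z x *_) (∑-filter (vertices (suc m)) (_≠ x) (invSq ∘ dist x) self-term) ⟨
    Z x * invSqSum x
      ≡⟨ recip-inverseˡ (invSqSum x) (invSqSum-pos x) ⟩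
    1ℚ ∎
    where
    open ≡-Reasoning
    self-term : ∀ v → ¬ T (v ≠ x) → invSq (dist x v) ≡ 0ℚ
    self-term v v≮x = cong invSq (trans (cong (dist x) (¬≠⇒≡ v≮x)) (dist-self x))

  weight-nonNeg : (c : V (suc m) → V (suc m)) → 0ℚ ≤ℚ weight c
  weight-nonNeg c = ∏-nonNeg (vertices (suc m)) (λ x → choice-nonNeg x (c x))

  total-mass : ∑ (choices (suc m)) weight ≡ 1ℚ
  total-mass = begin
    ∑ (choices (suc m)) weight
      ≡⟨ ∑-map (finFuns (suc m) rows) _ weight ⟩
    ∑ (finFuns (suc m) rows) (λ f → weight (λ x → f (proj₁ x) (proj₂ x)))
      ≡⟨ ∑-cong (finFuns (suc m) rows) (λ f → ∏-cartesianProduct (allFin (suc m)) (allFin (suc m))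
                                                 (λ x → choice x (f (proj₁ x) (proj₂ x)))) ⟩
    ∑ (finFuns (suc m) rows) (λ f → ∏ (allFin (suc m)) (λ i → row i (f i)))
      ≡⟨ ∑-finFuns-∏ (suc m) rows row ⟩
    ∏ (allFin (suc m)) (λ i → ∑ rows (row i))
      ≡⟨ ∏-one (allFin (suc m)) (λ i → trans (∑-finFuns-∏ (suc m) (vertices (suc m)) (λ j → choice (i , j)))
                                             (∏-one (allFin (suc m)) (λ j → choice-mass (i , j)))) ⟩
    1ℚ ∎
    where
    open ≡-Reasoning
    rows : List (Fin (suc m) → V (suc m))
    rows = finFuns (suc m) (vertices (suc m))
    row : Fin (suc m) → (Fin (suc m) → V (suc m)) → ℚ
    row i fᵢ = ∏ (allFin (suc m)) (λ j → choice (i , j) (fᵢ j))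

1-kp≤1-p : (k p : ℚ) → 1ℚ ≤ℚ k → 0ℚ ≤ℚ p → 1ℚ - k * p ≤ℚ 1ℚ - p
1-kp≤1-p k p 1≤k p≥0 = ℚ.+-monoʳ-≤ 1ℚ (ℚ.neg-antimono-≤ p≤kp)
  where p≤kp = subst (_≤ℚ k * p) (ℚ.*-identityˡ p) (ℚ.*-monoʳ-≤-nonNeg p {{nonNegative p≥0}} 1≤k)

lemma27 : (n : ℕ) → 3 ≤ n → (u : V n) →
    1ℚ - (+ 4 / 1) * Pr n (hasLongCycle u) ≤ℚ Pr n (detected u)
lemma27 (suc m) (s≤s 2≤m) u = begin
  1ℚ - (+ 4 / 1) * Pr (suc m) (hasLongCycle u)
    ≤⟨ 1-kp≤1-p (+ 4 / 1) (Pr (suc m) (hasLongCycle u)) (from-yes (1ℚ ℚ.≤? (+ 4 / 1)))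
                (mass-nonNeg (choices (suc m)) weight (weight-nonNeg 1≤m) (hasLongCycle u)) ⟩
  1ℚ - Pr (suc m) (hasLongCycle u)
    ≤⟨ complement-≤ (choices (suc m)) weight (weight-nonNeg 1≤m) (total-mass 1≤m) (noLongCycle⇒detected 2≤m u) ⟩
  Pr (suc m) (detected u) ∎
  where
  open ℚ.≤-Reasoning
  1≤m = ℕ.<⇒≤ 2≤m
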